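{- Let $G=(A\cup B,E)$ be a marriage instance with critical set $C\subseteq A$, let $G''$ be the instance constructed from $G$ as described in the context, and let $M''$ be a stable matching of $G''$. If some copy $m^i$ of a man $m\in A$ is matched in $M''$ to a non-dummy woman, then for every copy $m^j$ of $m$ with $j<i$, $m^j$ is matched in $M''$ to the dummy woman $d_m^{j+1}$ (the last dummy woman on the list of $m^j$).
   Context: A marriage instance is a bipartite graph $G=(A\cup B,E)$ ($A$ men, $B$ women) with strict preference lists; $\mathrm{Pref}(v)$ denotes the list of $v$; every vertex prefers being matched to being unmatched. A matching is stable if no edge $(a,b)$ outside it has both endpoints preferring each other to their current partners. Construction of $G''$: let $\ell=|C|$. For $m\in C$, $A''$ contains copies $m^0,\dots,m^{\ell+1}$ and $B''$ contains dummies $d_m^1,\dots,d_m^{\ell+1}$. For $m\in A\setminus C$, $A''$ contains copies $m^0,m^1$ and one dummy $d_m^1$. $B''$ also contains all of $B$. Preferences: for $m\in A\setminus C$: $m^0$: $\mathrm{Pref}(m)$ then $d_m^1$; $m^1$: $d_m^1$ then $\mathrm{Pref}(m)$. For $m\in C$: $m^0$: $\mathrm{Pref}(m)$ then $d_m^1$; $m^i$ ($1\le i\le\ell$): $d_m^i$, $\mathrm{Pref}(m)$, $d_m^{i+1}$; $m^{\ell+1}$: $d_m^{\ell+1}$ then $\mathrm{Pref}(m)$. For $w\in B$: the existing level-$(\ell+1)$ copies of the men of $\mathrm{Pref}(w)$ in the order of $\mathrm{Pref}(w)$, then the level-$\ell$ copies, and so on down to level $0$. For a dummy $d_m^i$: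 $m^{i-1}$ then $m^i$. -}

module Defs where

open import Data.Nat using (ℕ; zero; suc; _<?_)
open import Data.Fin using (Fin; zero; suc; inject₁; fromℕ<)
open import Data.Fin.Subset using (Subset; ∣_∣)
open import Data.Vec using (lookup)
open import Data.Bool using (if_then_else_)
open import Data.List using (List; []; _∷_; _++_; [_]; map; concatMap; mapMaybe; downFrom)
open import Data.List.Membership.Propositional using (_∈_)
open import Data.List.Relation.Unary.Unique.Propositional using (Unique)
open import Data.Maybe using (Maybe; just; nothing)
open import Data.Product using (Σ; _×_; ∃; ∃-syntax; _,_)
open import Data.Sum using (_⊎_; inj₁; inj₂)
open import Data.Empty using (⊥)
open import Function.Bundles using (_⇔_)
open import Relation.Binary.PropositionalEquality using (_≡_)
open import Relation.Nullary using (¬_; yes; no)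

-- Generic marriage instances (vertex sets as types, strict preference
-- lists; earlier in the list = more preferred).

record Instance : Set₁ where
  field
    Man   : Set
    Woman : Set
    prefM : Man → List Woman
    prefW : Woman → List Man
open Instance public

Before : {X : Set} → List X → X → X → Set
Before L x y = ∃[ L₁ ] ∃[ L₂ ] (L ≡ L₁ ++ (x ∷ L₂)) × (y ∈ L₂)

-- a vertex with list L strictly prefers x to its current status p
-- (p = nothing: unmatched; every acceptable partner beats being unmatched)
PrefersTo : {X : Set} → List X → X → Maybe X → Set
PrefersTo L x nothing  = x ∈ L
PrefersTo L x (just p) = Before L x p

record Matching (I : Instance) : Set where
  field
    μM : Man I → Maybe (Woman I)
    μW : Woman I → Maybe (Man I)
    consistent : ∀ a b → (μM a ≡ just b) ⇔ (μW b ≡ just a)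
    edges : ∀ a b → μM a ≡ just b → (b ∈ prefM I a) × (a ∈ prefW I b)
open Matching public

BlockingPair : (I : Instance) → Matching I → Man I → Woman I → Set
BlockingPair I M a b =
  (b ∈ prefM I a) × (a ∈ prefW I b) × ¬ (μM M a ≡ just b)
  × PrefersTo (prefM I a) b (μM M a) × PrefersTo (prefW I b) a (μW M b)

Stable : (I : Instance) → Matching I → Set
Stable I M = ∀ a b → ¬ BlockingPair I M a b

record MarriageInstance (nA nB : ℕ) : Set where
  field
    PrefA : Fin nA → List (Fin nB)
    PrefB : Fin nB → List (Fin nA)
    uniqueA : ∀ a → Unique (PrefA a)
    uniqueB : ∀ b → Unique (PrefB b)
    acceptable : ∀ a b → (b ∈ PrefA a) ⇔ (a ∈ PrefB b)
open MarriageInstance public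

module Construction {nA nB : ℕ} (G : MarriageInstance nA nB) (C : Subset nA) where

  ℓ : ℕ
  ℓ = ∣ C ∣

  top : Fin nA → ℕ
  top m = if lookup C m then suc ℓ else 1

  -- copies m^0 … m^(top m)
  Man'' : Set
  Man'' = Σ (Fin nA) (λ m → Fin (suc (top m)))

  -- dummy (m , k) stands for d_m^(k+1), k < top m
  Dummy : Set
  Dummy = Σ (Fin nA) (λ m → Fin (top m))

  Woman'' : Set
  Woman'' = Fin nB ⊎ Dummy

  -- index of d_m^i for copy m^i (present iff i ≥ 1)
  dummyBefore : ∀ t → Fin (suc t) → List (Fin t)
  dummyBefore t zero    = []
  dummyBefore t (suc i) = [ i ]

  -- index of d_m^(i+1) for copy m^i (present iff i < t)
  dummyAfter : ∀ t → Fin (suc t) → List (Fin t)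
  dummyAfter zero    zero    = []
  dummyAfter (suc t) zero    = [ zero ]
  dummyAfter (suc t) (suc j) = map suc (dummyAfter t j)

  prefM'' : Man'' → List Woman''
  prefM'' (m , i) =
    map (λ k → inj₂ (m , k)) (dummyBefore (top m) i)
    ++ map inj₁ (PrefA G m)
    ++ map (λ k → inj₂ (m , k)) (dummyAfter (top m) i)

  copyAt : ℕ → Fin nA → Maybe Man''
  copyAt k m with k <? suc (top m)
  ... | yes p = just (m , fromℕ< p)
  ... | no _  = nothing

  prefW'' : Woman'' → List Man''
  prefW'' (inj₁ w) =
    concatMap (λ k → mapMaybe (copyAt k) (PrefB G w)) (downFrom (suc (suc ℓ)))
  prefW'' (inj₂ (m , k)) = (m , inject₁ k) ∷ (m , suc k) ∷ []

  G'' : Instance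
  G'' = record { Man = Man'' ; Woman = Woman'' ; prefM = prefM'' ; prefW = prefW'' }

-- Each dummy d_m^(k+1) accepts only the two consecutive copies m^k and m^(k+1), and it heads the
-- list of m^(k+1). So in a stable matching it cannot stay single, and unless m^(k+1) takes it,
-- m^k must. If m^i is matched to a real woman, then m^(i-1) holds d_m^i; in particular m^(i-1)
-- does not hold its first dummy d_m^(i-1), which therefore goes to m^(i-2), and so on down to m^0.
module Submission where

open import Defs
open import Data.Nat using (ℕ; suc; _<_; s≤s)
open import Data.Fin using (Fin; zero; suc; toℕ; inject₁)
open import Data.Fin.Subset using (Subset)
open import Data.Fin.Properties using (≤∧≢⇒<; <⇒≤pred; <⇒≢; ≤̄⇒inject₁<)
open import Data.Fin.Induction using (<-wellFounded)
open import Induction.WellFounded using (Acc; acc)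
import Data.Fin as Fin
import Data.Nat.Properties as ℕ
open import Data.Maybe using (Maybe; just; nothing)
open import Data.Product using (∃-syntax; _,_; proj₁; proj₂)
open import Data.Sum using (inj₁; inj₂)
open import Data.List using (List; []; _∷_)
open import Data.List.Relation.Unary.Any using (here; there)
open import Data.List.Membership.Propositional using (_∈_)
open import Data.Empty using (⊥-elim)
open import Function.Bundles using (Equivalence)
open import Relation.Binary.PropositionalEquality using (_≡_; _≢_; refl; sym; trans; subst)
open import Relation.Nullary using (¬_; yes; no)

prefersTo-head : ∀ {X : Set} {x : X} {L : List X} {p : Maybe X}
               → (∀ {q} → p ≡ just q → q ∈ x ∷ L) → p ≢ just x → PrefersTo (x ∷ L) x p
prefersTo-head {p = nothing} _      _   = here refl
prefersTo-head {L = L} {p = just q} p∈x∷L p≢x with p∈x∷L refl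
... | here refl = ⊥-elim (p≢x refl)
... | there q∈L = [] , L , refl , q∈L

module _ {I : Instance} (M : Matching I) where

  partner-acceptable : ∀ {a b} → μW M b ≡ just a → a ∈ prefW I b
  partner-acceptable {a} {b} μb≡a = proj₂ (edges M a b (Equivalence.from (consistent M a b) μb≡a))

  stable⇒head-matched : Stable I M → ∀ {a b L} → prefM I a ≡ b ∷ L → a ∈ prefW I b
                      → ∃[ x ] μW M b ≡ just x
  stable⇒head-matched stable {a} {b} prefa≡b∷L a∈prefb with μW M b in μb≡
  ... | just x  = x , refl
  ... | nothing = ⊥-elim (stable a b
        ( subst (b ∈_) (sym prefa≡b∷L) (here refl)
        , a∈prefb
        , μa≢b
        , subst (λ L′ → PrefersTo L′ b (μM M a)) (sym prefa≡b∷L)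
            (prefersTo-head (λ {q} μa≡q → subst (q ∈_) prefa≡b∷L (proj₁ (edges M a q μa≡q))) μa≢b)
        , subst (PrefersTo (prefW I b) a) (sym μb≡) a∈prefb ))
    where
    μa≢b : μM M a ≢ just b
    μa≢b μa≡b with () ← trans (sym μb≡) (Equivalence.to (consistent M a b) μa≡b)

-- Holds i k reads "the copy m^i is matched to the dummy d_m^(k+1)".
module DummyChain {t : ℕ} (Holds : Fin (suc t) → Fin t → Set)
  (holds-functional : ∀ {i k k′} → Holds i k → Holds i k′ → k ≡ k′)
  (lower-holds : ∀ k → ¬ Holds (suc k) k → Holds (inject₁ k) k) where

  private
    DownwardFrom : Fin t → Set
    DownwardFrom k = ¬ Holds (suc k) k → ∀ j → j Fin.≤ k → Holds (inject₁ j) j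

    downward : ∀ k → Acc Fin._<_ k → DownwardFrom k
    downward zero    _         ¬h zero    _ = lower-holds zero ¬h
    downward (suc k) (acc rec) ¬h j j≤1+k with j Fin.≟ suc k
    ... | yes refl  = lower-holds (suc k) ¬h
    ... | no  j≢1+k = downward (inject₁ k) (rec k<1+k)
                        (λ h → <⇒≢ k<1+k (holds-functional h held)) j (<⇒≤pred (≤∧≢⇒< j≤1+k j≢1+k))
      where
      k<1+k : inject₁ k Fin.< suc k
      k<1+k = ≤̄⇒inject₁< ℕ.≤-refl

      held : Holds (suc (inject₁ k)) (suc k)
      held = lower-holds (suc k) ¬h

  lower-copies-hold : ∀ i → (∀ k → ¬ Holds i k) → ∀ j → j Fin.< i → Holds (inject₁ j) j
  lower-copies-hold (suc k) free j (s≤s j≤k) = downward k (<-wellFounded k) (free k) j j≤k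

module _ {nA nB : ℕ} (G : MarriageInstance nA nB) (C : Subset nA) where
  open Construction G C

  module _ (M : Matching G'') (stable : Stable G'' M) (m : Fin nA) where

    HoldsDummy : Fin (suc (top m)) → Fin (top m) → Set
    HoldsDummy i k = μM M (m , i) ≡ just (inj₂ (m , k))

    holdsDummy-functional : ∀ {i k k′} → HoldsDummy i k → HoldsDummy i k′ → k ≡ k′
    holdsDummy-functional h h′ with refl ← trans (sym h) h′ = refl

    dummy-held-by-lower-copy : ∀ k → ¬ HoldsDummy (suc k) k → HoldsDummy (inject₁ k) k
    dummy-held-by-lower-copy k ¬h
      with x , μd≡x ← stable⇒head-matched M stable {m , suc k} {inj₂ (m , k)} refl (there (here refl))
      with partner-acceptable M μd≡x
    ... | here refl         = Equivalence.from (consistent M x _) μd≡x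
    ... | there (here refl) = ⊥-elim (¬h (Equivalence.from (consistent M x _) μd≡x))

corollary3p1p2 : ∀ {nA nB : ℕ} (G : MarriageInstance nA nB) (C : Subset nA)
    → let open Construction G C in
    (M'' : Matching G'') → Stable G'' M''
    → ∀ (m : Fin nA) (i : Fin (suc (top m))) (j : Fin (top m))
    → toℕ j < toℕ i
    → (∃[ w ] μM M'' (m , i) ≡ just (inj₁ w))
    → μM M'' (m , inject₁ j) ≡ just (inj₂ (m , j))
corollary3p1p2 G C M stable m i j j<i (w , μi≡w) =
  DummyChain.lower-copies-hold (HoldsDummy G C M stable m)
    (holdsDummy-functional G C M stable m) (dummy-held-by-lower-copy G C M stable m)
    i not-dummy j j<i
  where
  not-dummy : ∀ k → ¬ HoldsDummy G C M stable m i k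
  not-dummy k μi≡d with () ← trans (sym μi≡w) μi≡d
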